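{- For the single-machine scheduling problem with uniform linear deterioration and release times, the Earliest Completion Time First (ECTF) algorithm is $O\!\left(1+\frac{1}{\beta^2}\right)$-approximate for minimizing the sum of completion times $\sum_{i\in\mathcal{J}}C_i$.
   Context: Problem: a single machine must process a set $\mathcal{J}=\{1,\ldots,n\}$ of jobs non-preemptively, at most one job at a time. Job $i$ has a release time $r_i\ge 0$ and a fixed processing time $\alpha_i\ge 0$, and there is a common deterioration rate $\beta>0$. If job $i$ starts at time $s_i\ge r_i$, its processing time is $p_i(s_i)=\alpha_i+\beta s_i$, so it completes at $C_i=(1+\beta)s_i+\alpha_i$. A schedule is feasible if jobs do not overlap and $s_i\ge r_i$ for all $i$. An algorithm is $\rho$-approximate for the total completion time if it always returns a feasible schedule with $\sum_i C_i$ at most $\rho$ times the optimum. ECTF algorithm: for a time $t$ and a job $i$, let $\Gamma_i(t)=(1+\beta)\max\{t,r_i\}+\alpha_i$. Starting at $t=0$, each time $t$ the machine becomes available, ECTF picks among the jobs not yet scheduled a job $i$ minimizing $\Gamma_i(t)$ and starts it at time $\max\{t,r_i\}$.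
   Formalization: The deterioration rate β, the release times $r_i$, the fixed processing times $\alpha_i$ and the start times of all schedules, those output by ECTF and the feasible ones compared with them, are rational. -}

module Defs where

open import Data.Nat using (ℕ)
open import Data.Fin using (Fin)
open import Data.List using (List; []; _∷_; allFin; foldr; map)
open import Data.List.Membership.Propositional using (_∈_)
open import Data.List.Relation.Binary.Permutation.Propositional using (_↭_)
open import Data.Rational using (ℚ; 0ℚ; 1ℚ; _+_; _*_; _⊔_; _≤_; _<_; 1/_; Positive; positive; >-nonZero; NonZero)
open import Data.Rational.Properties using (pos*pos⇒pos; positive⁻¹)
open import Data.Sum using (_⊎_)
open import Data.Product using (_×_)
open import Relation.Binary.PropositionalEquality using (_≡_; _≢_)

Σℚ : ∀ {n} → (Fin n → ℚ) → ℚ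
Σℚ {n} f = foldr _+_ 0ℚ (map f (allFin n))

invSq : (β : ℚ) → 0ℚ < β → ℚ
invSq β β>0 = 1/_ (β * β) {{nz}}
  where
    instance
      posβ : Positive β
      posβ = positive β>0
    nz : NonZero (β * β)
    nz = >-nonZero (positive⁻¹ (β * β) {{pos*pos⇒pos β β}})

module _ {n : ℕ} (β : ℚ) (r α : Fin n → ℚ) where

  completion : (s : Fin n → ℚ) → Fin n → ℚ
  completion s i = (1ℚ + β) * s i + α i

  totalCompletion : (Fin n → ℚ) → ℚ
  totalCompletion s = Σℚ (completion s)

  Feasible : (Fin n → ℚ) → Set
  Feasible s = (∀ i → r i ≤ s i)
             × (∀ i j → i ≢ j → completion s i ≤ s j ⊎ completion s j ≤ s i)

  Γ : ℚ → Fin n → ℚ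
  Γ t i = (1ℚ + β) * (t ⊔ r i) + α i

  -- ECTFRun t rem s : starting with the machine available at time t and the
  -- set rem of unscheduled jobs, ECTF (with some tie-breaking) schedules the
  -- jobs of rem at the start times given by s.
  data ECTFRun : ℚ → List (Fin n) → (Fin n → ℚ) → Set where
    done : ∀ {t s} → ECTFRun t [] s
    step : ∀ {t rem rem' s} (i : Fin n) →
           rem ↭ (i ∷ rem') →
           (∀ j → j ∈ rem → Γ t i ≤ Γ t j) →
           s i ≡ t ⊔ r i →
           ECTFRun (Γ t i) rem' s →
           ECTFRun t rem s

  ECTFSchedule : (Fin n → ℚ) → Set
  ECTFSchedule s = ECTFRun 0ℚ (allFin n) s

-- Sort the jobs by their completion times in a feasible schedule s*, giving the optimal
-- order o₁, o₂, …, oₙ; feasibility makes it a chain C*(oₖ₊₁) ≥ (1+β) C*(oₖ) + α(oₖ₊₁).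
-- The k-th completion time tₖ of ECTF is charged to C*(oₖ): β tₖ ≤ (1+β) C*(oₖ).
-- If oⱼ is the first job of the optimal order that ECTF has not scheduled after k jobs,
-- then j ≤ k+1 (pigeonhole) and β tₖ + α(oⱼ) ≤ (1+β)^(k+1-j) C*(oⱼ). Running oⱼ next
-- would complete it at (1+β)·max(tₖ, r(oⱼ)) + α(oⱼ), so ECTF's choice keeps this
-- invariant, and the chain turns it into the charge. Summing, β ∑C ≤ (1+β) ∑C*, i.e. ECTF
-- is (1 + 1/β)-approximate, and 1 + 1/β ≤ 2 (1 + 1/β²).

module Submission where

open import Defs
open import Data.Nat using (ℕ)
open import Data.Fin using (Fin)
open import Data.Product using (Σ)
open import Data.Rational using (ℚ; 0ℚ; 1ℚ; _+_; _*_; _≤_; _<_)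

open import Algebra.Bundles using (CommutativeRing)
open import Data.Empty using (⊥-elim)
import Data.Fin.Properties as Fin
open import Data.List using (List; []; _∷_; _++_; [_]; foldr; map; length; drop; allFin)
import Data.List.Membership.DecPropositional as DecMembership
open import Data.List.Membership.Propositional using (_∈_)
open import Data.List.Membership.Propositional.Properties using (∈-∃++; ∈-length)
open import Data.List.Properties using (drop-drop; length-drop)
open import Data.List.Relation.Binary.Permutation.Propositional using (_↭_; ↭-sym; ↭⇒↭ₛ)
open import Data.List.Relation.Binary.Permutation.Propositional.Properties
  using (∈-resp-↭; ↭-length; shift; map⁺)
import Data.List.Relation.Binary.Permutation.Setoid.Properties as Permutationₛ
open import Data.List.Relation.Binary.Subset.Propositional using (_⊆_)
open import Data.List.Relation.Binary.Subset.Propositional.Properties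
  using (⊆-trans; ⊆-respʳ-↭; ⊆-reflexive-↭; xs⊆x∷xs; ⊆∷∧∉⇒⊆)
import Data.List.Relation.Unary.All as All
open import Data.List.Relation.Unary.AllPairs as AllPairs using (_∷_)
open import Data.List.Relation.Unary.Any using (here; there)
open import Data.List.Relation.Unary.Linked using (Linked; []; [-]; _∷_)
open import Data.List.Relation.Unary.Linked.Properties using (AllPairs⇒Linked; Linked⇒AllPairs)
open import Data.List.Relation.Unary.Unique.Propositional using (Unique)
open import Data.List.Relation.Unary.Unique.Propositional.Properties using (allFin⁺)
import Data.List.Sort
import Data.Nat as ℕ
open import Data.Nat using (zero; suc)
import Data.Nat.Properties as ℕₚ
open import Data.Product using (∃-syntax; _,_; _×_; proj₁; proj₂)
open import Data.Rational using (-_; _⊔_; nonNegative; positive; Positive)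
import Data.Rational.Properties as ℚₚ
open import Data.Rational.Solver using (module +-*-Solver)
open import Data.Sum using (inj₁; inj₂)
open import Relation.Binary.Construct.On as On using ()
open import Relation.Binary.Definitions using (DecidableEquality)
open import Relation.Binary.PropositionalEquality
  using (_≡_; _≢_; refl; sym; trans; cong; subst; subst₂; setoid)
open import Relation.Nullary using (yes; no)
open import Algebra.Properties.Semiring.Exp (CommutativeRing.semiring ℚₚ.+-*-commutativeRing)
  using (_^_; ^-homo-*)

open +-*-Solver

module _ {A : Set} where

  sumℚ : (A → ℚ) → List A → ℚ
  sumℚ f xs = foldr _+_ 0ℚ (map f xs)

  sumℚ-↭ : ∀ (f : A → ℚ) {xs ys} → xs ↭ ys → sumℚ f xs ≡ sumℚ f ys
  sumℚ-↭ f xs↭ys =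
    Permutationₛ.foldr-commMonoid (setoid ℚ) ℚₚ.+-0-isCommutativeMonoid (↭⇒↭ₛ (map⁺ f xs↭ys))

  sumℚ-nonNeg : ∀ {f : A → ℚ} → (∀ x → 0ℚ ≤ f x) → ∀ xs → 0ℚ ≤ sumℚ f xs
  sumℚ-nonNeg f≥0 []       = ℚₚ.≤-refl
  sumℚ-nonNeg f≥0 (x ∷ xs) = ℚₚ.+-mono-≤ (f≥0 x) (sumℚ-nonNeg f≥0 xs)

  Unique-resp-↭ : ∀ {xs ys : List A} → xs ↭ ys → Unique xs → Unique ys
  Unique-resp-↭ xs↭ys = Permutationₛ.Unique-resp-↭ (setoid A) (↭⇒↭ₛ xs↭ys)

  Unique⇒length≤ : ∀ {xs ys : List A} → Unique xs → xs ⊆ ys → length xs ℕ.≤ length ys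
  Unique⇒length≤ {[]}     _               _       = ℕ.z≤n
  Unique⇒length≤ {x ∷ xs} (x∉xs ∷ unique) x∷xs⊆ys
    with as , bs , refl ← ∈-∃++ (x∷xs⊆ys (here refl)) = begin
      suc (length xs)             ≤⟨ ℕ.s≤s (Unique⇒length≤ unique xs⊆as++bs) ⟩
      suc (length (as ++ bs))     ≡⟨ ↭-length (shift x as bs) ⟨
      length (as ++ [ x ] ++ bs)  ∎
    where
    open ℕₚ.≤-Reasoning
    xs⊆as++bs : xs ⊆ as ++ bs
    xs⊆as++bs = ⊆∷∧∉⇒⊆ (⊆-respʳ-↭ (shift x as bs) (⊆-trans (xs⊆x∷xs xs x) x∷xs⊆ys))
                        (λ x∈xs → All.lookup x∉xs x∈xs refl)

  Linked-drop : ∀ {R : A → A → Set} d {xs} → Linked R xs → Linked R (drop d xs)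
  Linked-drop zero    l       = l
  Linked-drop (suc d) []      = []
  Linked-drop (suc d) [-]     = Linked-drop d []
  Linked-drop (suc d) (_ ∷ l) = Linked-drop d l

  drop-suc : ∀ m (xs : List A) {w ws} → drop m xs ≡ w ∷ ws → drop (suc m) xs ≡ ws
  drop-suc zero    (x ∷ xs) refl = refl
  drop-suc (suc m) (x ∷ xs) eq   = drop-suc m xs eq

  drop-length-≤⇒≤ : ∀ d k (xs : List A) →
                    0 ℕ.< length (drop k xs) → length (drop k xs) ℕ.≤ length (drop d xs) → d ℕ.≤ k
  drop-length-≤⇒≤ zero    k       xs       _  _ = ℕ.z≤n
  drop-length-≤⇒≤ (suc d) zero    (x ∷ xs) _  h =
    ⊥-elim (ℕₚ.<-irrefl refl (ℕₚ.≤-trans h |drop-d|≤|xs|))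
    where
    |drop-d|≤|xs| : length (drop d xs) ℕ.≤ length xs
    |drop-d|≤|xs| = ℕₚ.≤-trans (ℕₚ.≤-reflexive (length-drop d xs)) (ℕₚ.m∸n≤m _ d)
  drop-length-≤⇒≤ (suc d) (suc k) (x ∷ xs) >0 h = ℕ.s≤s (drop-length-≤⇒≤ d k xs >0 h)

  module _ (_≟_ : DecidableEquality A) where
    open DecMembership _≟_ using (_∈?_)

    first-member : ∀ (xs : List A) {ys y} → y ∈ ys → ys ⊆ xs →
                   ∃[ d ] ∃[ v ] ∃[ vs ] drop d xs ≡ v ∷ vs × v ∈ ys × ys ⊆ v ∷ vs
    first-member []       y∈ys ys⊆[] with () ← ys⊆[] y∈ys
    first-member (x ∷ xs) {ys} y∈ys ys⊆x∷xs with x ∈? ys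
    ... | yes x∈ys = 0 , x , xs , refl , x∈ys , ys⊆x∷xs
    ... | no  x∉ys with d , v , vs , eq , v∈ys , ys⊆ ← first-member xs y∈ys (⊆∷∧∉⇒⊆ ys⊆x∷xs x∉ys)
      = suc d , v , vs , eq , v∈ys , ys⊆

module _ {p q r : ℚ} where

  nonNeg-*-monoˡ-≤ : 0ℚ ≤ r → p ≤ q → r * p ≤ r * q
  nonNeg-*-monoˡ-≤ r≥0 = ℚₚ.*-monoˡ-≤-nonNeg r {{nonNegative r≥0}}

  nonNeg-*-monoʳ-≤ : 0ℚ ≤ r → p ≤ q → p * r ≤ q * r
  nonNeg-*-monoʳ-≤ r≥0 = ℚₚ.*-monoʳ-≤-nonNeg r {{nonNegative r≥0}}

nonNeg-* : ∀ {p q} → 0ℚ ≤ p → 0ℚ ≤ q → 0ℚ ≤ p * q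
nonNeg-* {p} p≥0 q≥0 = ℚₚ.≤-trans (ℚₚ.≤-reflexive (sym (ℚₚ.*-zeroʳ p))) (nonNeg-*-monoˡ-≤ p≥0 q≥0)

p≤p+q : ∀ {p q} → 0ℚ ≤ q → p ≤ p + q
p≤p+q {p} q≥0 = ℚₚ.≤-trans (ℚₚ.≤-reflexive (sym (ℚₚ.+-identityʳ p))) (ℚₚ.+-monoʳ-≤ p q≥0)

+-cancelˡ-≤ : ∀ x {y z} → x + y ≤ x + z → y ≤ z
+-cancelˡ-≤ x {y} {z} h = begin
  y                ≡⟨ solve 2 (λ x y → y := (:- x) :+ (x :+ y)) refl x y ⟩
  (- x) + (x + y)  ≤⟨ ℚₚ.+-monoʳ-≤ (- x) h ⟩
  (- x) + (x + z)  ≡⟨ solve 2 (λ x z → (:- x) :+ (x :+ z) := z) refl x z ⟩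
  z                ∎
  where open ℚₚ.≤-Reasoning

0≤1 : 0ℚ ≤ 1ℚ
0≤1 = ℚₚ.<⇒≤ (ℚₚ.positive⁻¹ 1ℚ)

1≤^ : ∀ {x} k → 1ℚ ≤ x → 1ℚ ≤ x ^ k
1≤^     zero    _   = ℚₚ.≤-refl
1≤^ {x} (suc k) 1≤x = begin
  1ℚ          ≡⟨ ℚₚ.*-identityˡ 1ℚ ⟨
  1ℚ * 1ℚ     ≤⟨ nonNeg-*-monoʳ-≤ 0≤1 1≤x ⟩
  x * 1ℚ      ≤⟨ nonNeg-*-monoˡ-≤ (ℚₚ.≤-trans 0≤1 1≤x) (1≤^ k 1≤x) ⟩
  x * x ^ k   ∎
  where open ℚₚ.≤-Reasoning

≤-rebase : ∀ {x a a′ P Q c c′} → 0ℚ ≤ a → 0ℚ ≤ a′ → 1ℚ ≤ P →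
           x + a ≤ P * (Q * c) → Q * c + a′ ≤ c′ → x + a′ ≤ P * c′
≤-rebase {x} {a} {a′} {P} {Q} {c} {c′} a≥0 a′≥0 P≥1 x+a≤ Qc+a′≤c′ = begin
  x + a′                ≤⟨ ℚₚ.+-monoˡ-≤ a′ (ℚₚ.≤-trans (p≤p+q {x} a≥0) x+a≤) ⟩
  P * (Q * c) + a′      ≤⟨ ℚₚ.+-monoʳ-≤ (P * (Q * c)) a′≤Pa′ ⟩
  P * (Q * c) + P * a′  ≡⟨ ℚₚ.*-distribˡ-+ P (Q * c) a′ ⟨
  P * (Q * c + a′)      ≤⟨ nonNeg-*-monoˡ-≤ (ℚₚ.≤-trans 0≤1 P≥1) Qc+a′≤c′ ⟩
  P * c′                ∎
  where
  open ℚₚ.≤-Reasoning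
  a′≤Pa′ : a′ ≤ P * a′
  a′≤Pa′ = ℚₚ.≤-trans (ℚₚ.≤-reflexive (sym (ℚₚ.*-identityˡ a′))) (nonNeg-*-monoʳ-≤ a′≥0 P≥1)

module ApproximationRatio {n : ℕ} (β : ℚ) (β>0 : 0ℚ < β) (r α : Fin n → ℚ)
  (r≥0 : ∀ i → 0ℚ ≤ r i) (α≥0 : ∀ i → 0ℚ ≤ α i)
  (s* : Fin n → ℚ) (feasible : Feasible β r α s*) where

  open ℚₚ.≤-Reasoning

  b : ℚ
  b = 1ℚ + β

  C* : Fin n → ℚ
  C* = completion β r α s*

  β≥0 : 0ℚ ≤ β
  β≥0 = ℚₚ.<⇒≤ β>0

  1≤b : 1ℚ ≤ b
  1≤b = p≤p+q β≥0

  b≥0 : 0ℚ ≤ b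
  b≥0 = ℚₚ.≤-trans 0≤1 1≤b

  s*≥0 : ∀ i → 0ℚ ≤ s* i
  s*≥0 i = ℚₚ.≤-trans (r≥0 i) (proj₁ feasible i)

  α≤C* : ∀ i → α i ≤ C* i
  α≤C* i = begin
    α i               ≡⟨ ℚₚ.+-identityˡ (α i) ⟨
    0ℚ + α i          ≤⟨ ℚₚ.+-monoˡ-≤ (α i) (nonNeg-* b≥0 (s*≥0 i)) ⟩
    b * s* i + α i    ∎

  C*≥0 : ∀ i → 0ℚ ≤ C* i
  C*≥0 i = ℚₚ.≤-trans (α≥0 i) (α≤C* i)

  C*≤b^*C* : ∀ m i → C* i ≤ b ^ m * C* i
  C*≤b^*C* m i = ℚₚ.≤-trans (ℚₚ.≤-reflexive (sym (ℚₚ.*-identityˡ (C* i))))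
                            (nonNeg-*-monoʳ-≤ (C*≥0 i) (1≤^ m 1≤b))

  C*≤s*⇒C*≤0 : ∀ i → C* i ≤ s* i → C* i ≤ 0ℚ
  C*≤s*⇒C*≤0 i C*≤s* = ℚₚ.≤-trans C*≤s* s*≤0
    where
    βs*≤0 : β * s* i ≤ β * 0ℚ
    βs*≤0 = +-cancelˡ-≤ (s* i) (begin
      s* i + β * s* i           ≤⟨ p≤p+q (α≥0 i) ⟩
      s* i + β * s* i + α i     ≡⟨ solve 3 (λ β s a → s :+ β :* s :+ a := (con 1ℚ :+ β) :* s :+ a)
                                          refl β (s* i) (α i) ⟩
      C* i                      ≤⟨ C*≤s* ⟩
      s* i                      ≡⟨ solve 2 (λ β s → s := s :+ β :* con 0ℚ) refl β (s* i) ⟩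
      s* i + β * 0ℚ             ∎)
    s*≤0 : s* i ≤ 0ℚ
    s*≤0 = ℚₚ.*-cancelˡ-≤-pos β {{positive β>0}} βs*≤0

  -- What feasibility gives when v runs after u, i.e. when C*(u) ≤ s*(v).
  _≺_ : Fin n → Fin n → Set
  u ≺ v = b * C* u + α v ≤ C* v

  ≺-sorted : ∀ {u v} → u ≢ v → C* u ≤ C* v → u ≺ v
  ≺-sorted {u} {v} u≢v C*u≤C*v with proj₂ feasible u v u≢v
  ... | inj₁ C*u≤s*v = ℚₚ.+-monoˡ-≤ (α v) (nonNeg-*-monoˡ-≤ b≥0 C*u≤s*v)
  ... | inj₂ C*v≤s*u = begin
    b * C* u + α v   ≤⟨ ℚₚ.+-monoˡ-≤ (α v) (nonNeg-*-monoˡ-≤ b≥0 C*u≤0) ⟩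
    b * 0ℚ + α v     ≡⟨ solve 2 (λ b a → b :* con 0ℚ :+ a := a) refl b (α v) ⟩
    α v              ≤⟨ α≤C* v ⟩
    C* v             ∎
    where
    C*u≤0 : C* u ≤ 0ℚ
    C*u≤0 = C*≤s*⇒C*≤0 u (ℚₚ.≤-trans C*u≤C*v C*v≤s*u)

  ≺⇒b*C*≤C* : ∀ {u v} → u ≺ v → b * C* u ≤ C* v
  ≺⇒b*C*≤C* {v = v} = ℚₚ.≤-trans (p≤p+q (α≥0 v))

  ≺-chain : ∀ d {u S v vs} → Linked _≺_ (u ∷ S) → drop (suc d) (u ∷ S) ≡ v ∷ vs →
            b ^ suc d * C* u + α v ≤ C* v
  ≺-chain zero    {u} {v ∷ _} (u≺v ∷ _) refl = begin
    b * 1ℚ * C* u + α v  ≡⟨ cong (λ x → x * C* u + α v) (ℚₚ.*-identityʳ b) ⟩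
    b * C* u + α v       ≤⟨ u≺v ⟩
    C* v                 ∎
  ≺-chain (suc d) {u} {x ∷ xs} {v} (u≺x ∷ l) eq = begin
    b * b ^ suc d * C* u + α v    ≡⟨ cong (_+ α v) (reassociate b (b ^ suc d) (C* u)) ⟩
    b ^ suc d * (b * C* u) + α v  ≤⟨ ℚₚ.+-monoˡ-≤ (α v) (nonNeg-*-monoˡ-≤ b^≥0 (≺⇒b*C*≤C* u≺x)) ⟩
    b ^ suc d * C* x + α v        ≤⟨ ≺-chain d l eq ⟩
    C* v                          ∎
    where
    reassociate : ∀ b p c → b * p * c ≡ p * (b * c)
    reassociate = solve 3 (λ b p c → b :* p :* c := p :* (b :* c)) refl
    b^≥0 : 0ℚ ≤ b ^ suc d
    b^≥0 = ℚₚ.≤-trans 0≤1 (1≤^ (suc d) 1≤b)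

  ≺-chain-≤ : ∀ m {u S w ws} → Linked _≺_ (u ∷ S) → drop m (u ∷ S) ≡ w ∷ ws → b ^ m * C* u ≤ C* w
  ≺-chain-≤ zero    {u} _ refl = ℚₚ.≤-reflexive (ℚₚ.*-identityˡ (C* u))
  ≺-chain-≤ (suc m) {w = w} sorted eq = ℚₚ.≤-trans (p≤p+q (α≥0 w)) (≺-chain m sorted eq)

  ≺-rebase : ∀ d m′ {u S v vs x} → Linked _≺_ (u ∷ S) → drop d (u ∷ S) ≡ v ∷ vs →
             x + α u ≤ b ^ (m′ ℕ.+ d) * C* u → x + α v ≤ b ^ m′ * C* v
  ≺-rebase zero    m′ {u} _ refl bound = subst (λ k → _ ≤ b ^ k * C* u) (ℕₚ.+-identityʳ m′) bound
  ≺-rebase (suc d) m′ {u} {v = v} {x = x} sorted eq bound =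
    ≤-rebase {x} {Q = b ^ suc d} {c = C* u} (α≥0 u) (α≥0 v) (1≤^ m′ 1≤b)
             (ℚₚ.≤-trans bound (ℚₚ.≤-reflexive split)) (≺-chain d sorted eq)
    where
    split : b ^ (m′ ℕ.+ suc d) * C* u ≡ b ^ m′ * (b ^ suc d * C* u)
    split = trans (cong (_* C* u) (^-homo-* b m′ (suc d))) (ℚₚ.*-assoc (b ^ m′) (b ^ suc d) (C* u))

  Γ-bound : ∀ t u X → C* u ≤ X → β * t + α u ≤ X → β * Γ β r α t u + α u ≤ b * X
  Γ-bound t u X C*u≤X βt+α≤X with ℚₚ.≤-total t (r u)
  ... | inj₁ t≤r = begin
    β * (b * (t ⊔ r u) + α u) + α u  ≡⟨ cong (λ z → β * (b * z + α u) + α u) (ℚₚ.p≤q⇒p⊔q≡q t≤r) ⟩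
    β * (b * r u + α u) + α u        ≤⟨ ℚₚ.+-mono-≤ (nonNeg-*-monoˡ-≤ β≥0 released) (α≤C* u) ⟩
    β * C* u + C* u                  ≡⟨ solve 2 (λ β c → β :* c :+ c := (con 1ℚ :+ β) :* c) refl β (C* u) ⟩
    b * C* u                         ≤⟨ nonNeg-*-monoˡ-≤ b≥0 C*u≤X ⟩
    b * X                            ∎
    where
    released : b * r u + α u ≤ C* u
    released = ℚₚ.+-monoˡ-≤ (α u) (nonNeg-*-monoˡ-≤ b≥0 (proj₁ feasible u))
  ... | inj₂ r≤t = begin
    β * (b * (t ⊔ r u) + α u) + α u  ≡⟨ cong (λ z → β * (b * z + α u) + α u) (ℚₚ.p≥q⇒p⊔q≡p r≤t) ⟩
    β * (b * t + α u) + α u          ≡⟨ solve 3 (λ β t a → β :* ((con 1ℚ :+ β) :* t :+ a) :+ a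
                                                      := (con 1ℚ :+ β) :* (β :* t :+ a)) refl β t (α u) ⟩
    b * (β * t + α u)                ≤⟨ nonNeg-*-monoˡ-≤ b≥0 βt+α≤X ⟩
    b * X                            ∎

  -- ECTF is at time t with the jobs rem still unscheduled, whose completions are charged
  -- to P, the last |rem| jobs of the optimal order. The suffix job ∷ suffix of the optimal
  -- order contains rem, and P lies lag positions further along it.
  record Frontier (t : ℚ) (rem P : List (Fin n)) : Set where
    field
      job      : Fin n
      suffix   : List (Fin n)
      lag      : ℕ
      sorted   : Linked _≺_ (job ∷ suffix)
      rem⊆     : rem ⊆ job ∷ suffix
      unique   : Unique rem
      charged  : drop lag (job ∷ suffix) ≡ P
      balanced : length P ≡ length rem
      bound    : β * t + α job ≤ b ^ lag * C* job

  advance : ∀ {t rem P y} → Frontier t rem P → y ∈ rem →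
            Σ (Frontier t rem P) λ F → Frontier.job F ∈ rem
  advance {t} {rem} {P} F y∈rem
    with d , v , vs , dropped , v∈rem , rem⊆v∷vs ←
         first-member Fin._≟_ (Frontier.job F ∷ Frontier.suffix F) y∈rem (Frontier.rem⊆ F)
    = record
        { job = v ; suffix = vs ; lag = lag ℕ.∸ d
        ; sorted = subst (Linked _≺_) dropped (Linked-drop d sorted)
        ; rem⊆ = rem⊆v∷vs ; unique = unique ; charged = charged′ ; balanced = balanced
        ; bound = ≺-rebase d (lag ℕ.∸ d) {x = β * t} sorted dropped
                    (subst (λ k → β * t + α job ≤ b ^ k * C* job) (sym (ℕₚ.m∸n+n≡m d≤lag)) bound)
        }
      , v∈rem
    where
    open Frontier F
    |P|≡|rem| : length (drop lag (job ∷ suffix)) ≡ length rem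
    |P|≡|rem| = trans (cong length charged) balanced
    d≤lag : d ℕ.≤ lag
    d≤lag = drop-length-≤⇒≤ d lag (job ∷ suffix)
      (subst (0 ℕ.<_) (sym |P|≡|rem|) (∈-length y∈rem))
      (subst₂ ℕ._≤_ (sym |P|≡|rem|) (cong length (sym dropped)) (Unique⇒length≤ unique rem⊆v∷vs))
    charged′ : drop (lag ℕ.∸ d) (v ∷ vs) ≡ P
    charged′ = trans (cong (drop (lag ℕ.∸ d)) (sym dropped))
                 (trans (drop-drop d (lag ℕ.∸ d) (job ∷ suffix))
                   (trans (cong (λ k → drop k (job ∷ suffix)) (ℕₚ.m+[n∸m]≡n d≤lag)) charged))

  schedule-next : ∀ {t rem rem′ P} (F : Frontier t rem P) → Frontier.job F ∈ rem →
                  ∀ i → rem ↭ i ∷ rem′ → (∀ j → j ∈ rem → Γ β r α t i ≤ Γ β r α t j) →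
                  ∃[ w ] ∃[ ws ] P ≡ w ∷ ws × β * Γ β r α t i ≤ b * C* w ×
                                 Frontier (Γ β r α t i) rem′ ws
  schedule-next {P = []} F _ _ rem↭ _ =
    ⊥-elim (ℕₚ.0≢1+n (trans (Frontier.balanced F) (↭-length rem↭)))
  schedule-next {t} {rem} {rem′} {w ∷ ws} F job∈rem i rem↭ i-first =
    w , ws , refl , charge-i ,
    record
      { job = job ; suffix = suffix ; lag = suc lag ; sorted = sorted
      ; rem⊆ = λ j∈rem′ → rem⊆ (∈-resp-↭ (↭-sym rem↭) (there j∈rem′))
      ; unique = AllPairs.tail (Unique-resp-↭ rem↭ unique)
      ; charged = drop-suc lag (job ∷ suffix) charged
      ; balanced = ℕₚ.suc-injective (trans balanced (↭-length rem↭))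
      ; bound = ℚₚ.≤-trans after (ℚₚ.≤-reflexive (sym (ℚₚ.*-assoc b (b ^ lag) (C* job))))
      }
    where
    open Frontier F
    after : β * Γ β r α t i + α job ≤ b * (b ^ lag * C* job)
    after = ℚₚ.≤-trans (ℚₚ.+-monoˡ-≤ (α job) (nonNeg-*-monoˡ-≤ β≥0 (i-first job job∈rem)))
                       (Γ-bound t job (b ^ lag * C* job) (C*≤b^*C* lag job) bound)
    charge-i : β * Γ β r α t i ≤ b * C* w
    charge-i = begin
      β * Γ β r α t i            ≤⟨ p≤p+q (α≥0 job) ⟩
      β * Γ β r α t i + α job    ≤⟨ after ⟩
      b * (b ^ lag * C* job)     ≤⟨ nonNeg-*-monoˡ-≤ b≥0 (≺-chain-≤ lag sorted charged) ⟩
      b * C* w                   ∎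

  charge : ∀ {s t rem P} → ECTFRun β r α t rem s → Frontier t rem P →
           β * sumℚ (completion β r α s) rem ≤ b * sumℚ C* P
  charge {P = P} done _ = begin
    β * 0ℚ           ≡⟨ ℚₚ.*-zeroʳ β ⟩
    0ℚ               ≤⟨ nonNeg-* b≥0 (sumℚ-nonNeg C*≥0 P) ⟩
    b * sumℚ C* P    ∎
  charge {s} {t} {rem} (step {rem' = rem′} i rem↭ i-first sᵢ run) F
    with F′ , job∈rem ← advance F (∈-resp-↭ (↭-sym rem↭) (here refl))
    with w , ws , refl , charge-i , F″ ← schedule-next F′ job∈rem i rem↭ i-first = begin
      β * sumℚ C rem                     ≡⟨ cong (β *_) (sumℚ-↭ C rem↭) ⟩
      β * (C i + sumℚ C rem′)            ≡⟨ ℚₚ.*-distribˡ-+ β (C i) (sumℚ C rem′) ⟩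
      β * C i + β * sumℚ C rem′          ≡⟨ cong (λ x → β * (b * x + α i) + β * sumℚ C rem′) sᵢ ⟩
      β * Γ β r α t i + β * sumℚ C rem′  ≤⟨ ℚₚ.+-mono-≤ charge-i (charge run F″) ⟩
      b * C* w + b * sumℚ C* ws          ≡⟨ ℚₚ.*-distribˡ-+ b (C* w) (sumℚ C* ws) ⟨
      b * sumℚ C* (w ∷ ws)               ∎
    where
    C : Fin n → ℚ
    C = completion β r α s

  open Data.List.Sort (On.decTotalOrder ℚₚ.≤-decTotalOrder C*) using (sort; sort-↭; sort-↗)

  optimal-order-≺ : Linked _≺_ (sort (allFin n))
  optimal-order-≺ = AllPairs⇒Linked (AllPairs.zipWith (λ (u≢v , C*u≤C*v) → ≺-sorted u≢v C*u≤C*v)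
    ( Unique-resp-↭ (↭-sym (sort-↭ (allFin n))) (allFin⁺ n)
    , Linked⇒AllPairs ℚₚ.≤-trans (sort-↗ (allFin n))))

  ectf-ratio : ∀ s → ECTFSchedule β r α s →
               β * totalCompletion β r α s ≤ b * totalCompletion β r α s*
  ectf-ratio s ectf with sort (allFin n) | sort-↭ (allFin n) | optimal-order-≺
  ... | [] | O↭all | _ = begin
    β * sumℚ C (allFin n)          ≡⟨ cong (β *_) (sumℚ-↭ C (↭-sym O↭all)) ⟩
    β * 0ℚ                         ≡⟨ ℚₚ.*-zeroʳ β ⟩
    0ℚ                             ≤⟨ nonNeg-* b≥0 (sumℚ-nonNeg C*≥0 (allFin n)) ⟩
    b * sumℚ C* (allFin n)         ∎
    where
    C : Fin n → ℚ
    C = completion β r α s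
  ... | u ∷ S | O↭all | sorted = begin
    β * totalCompletion β r α s    ≤⟨ charge ectf initial ⟩
    b * sumℚ C* (u ∷ S)            ≡⟨ cong (b *_) (sumℚ-↭ C* O↭all) ⟩
    b * sumℚ C* (allFin n)         ∎
    where
    initial : Frontier 0ℚ (allFin n) (u ∷ S)
    initial = record
      { job = u ; suffix = S ; lag = 0 ; sorted = sorted
      ; rem⊆ = ⊆-reflexive-↭ (↭-sym O↭all) ; unique = allFin⁺ n
      ; charged = refl ; balanced = ↭-length O↭all
      ; bound = begin
          β * 0ℚ + α u   ≡⟨ solve 2 (λ β a → β :* con 0ℚ :+ a := a) refl β (α u) ⟩
          α u            ≤⟨ α≤C* u ⟩
          C* u           ≡⟨ ℚₚ.*-identityˡ (C* u) ⟨
          1ℚ * C* u      ∎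
      }

1+β≤β*2[1+β⁻²] : ∀ β (β>0 : 0ℚ < β) → 1ℚ + β ≤ β * ((1ℚ + 1ℚ) * (1ℚ + invSq β β>0))
1+β≤β*2[1+β⁻²] β β>0 = begin
  1ℚ + β                     ≤⟨ ℚₚ.+-mono-≤ 1≤β+βq (p≤p+q {β} βq≥0) ⟩
  (β + β * q) + (β + β * q)  ≡⟨ solve 2 (λ β q → (β :+ β :* q) :+ (β :+ β :* q)
                                        := β :* ((con 1ℚ :+ con 1ℚ) :* (con 1ℚ :+ q))) refl β q ⟩
  β * ((1ℚ + 1ℚ) * (1ℚ + q)) ∎
  where
  open ℚₚ.≤-Reasoning
  instance
    β-pos : Positive β
    β-pos = positive β>0
    ββ-pos : Positive (β * β)
    ββ-pos = ℚₚ.pos*pos⇒pos β β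
  q : ℚ
  q = invSq β β>0
  β≥0 : 0ℚ ≤ β
  β≥0 = ℚₚ.<⇒≤ β>0
  βq≥0 : 0ℚ ≤ β * q
  βq≥0 = nonNeg-* β≥0 (ℚₚ.<⇒≤ (ℚₚ.positive⁻¹ q {{ℚₚ.1/pos⇒pos (β * β)}}))
  β*βq≡1 : β * (β * q) ≡ 1ℚ
  β*βq≡1 = trans (sym (ℚₚ.*-assoc β β q)) (ℚₚ.*-inverseʳ (β * β) {{ℚₚ.pos⇒nonZero (β * β)}})
  1≤β+βq : 1ℚ ≤ β + β * q
  1≤β+βq with ℚₚ.≤-total 1ℚ β
  ... | inj₁ 1≤β = ℚₚ.≤-trans 1≤β (p≤p+q βq≥0)
  ... | inj₂ β≤1 = begin
    1ℚ              ≡⟨ β*βq≡1 ⟨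
    β * (β * q)     ≤⟨ nonNeg-*-monoʳ-≤ βq≥0 β≤1 ⟩
    1ℚ * (β * q)    ≡⟨ ℚₚ.*-identityˡ (β * q) ⟩
    β * q           ≡⟨ ℚₚ.+-identityˡ (β * q) ⟨
    0ℚ + β * q      ≤⟨ ℚₚ.+-monoˡ-≤ (β * q) β≥0 ⟩
    β + β * q       ∎

corollary18 : Σ ℚ λ c → (n : ℕ) (β : ℚ) (β>0 : 0ℚ < β) (r α : Fin n → ℚ) →
    (∀ i → 0ℚ ≤ r i) → (∀ i → 0ℚ ≤ α i) →
    (s : Fin n → ℚ) → ECTFSchedule β r α s →
    (s* : Fin n → ℚ) → Feasible β r α s* →
    totalCompletion β r α s ≤ (c * (1ℚ + invSq β β>0)) * totalCompletion β r α s*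
corollary18 = 1ℚ + 1ℚ , λ n β β>0 r α r≥0 α≥0 s ectf s* feasible →
  let open ApproximationRatio β β>0 r α r≥0 α≥0 s* feasible
      open ℚₚ.≤-Reasoning
      c = (1ℚ + 1ℚ) * (1ℚ + invSq β β>0)
  in ℚₚ.*-cancelˡ-≤-pos β {{positive β>0}} (begin
       β * totalCompletion β r α s        ≤⟨ ectf-ratio s ectf ⟩
       b * totalCompletion β r α s*       ≤⟨ nonNeg-*-monoʳ-≤ (sumℚ-nonNeg C*≥0 (allFin n))
                                                              (1+β≤β*2[1+β⁻²] β β>0) ⟩
       β * c * totalCompletion β r α s*   ≡⟨ ℚₚ.*-assoc β c _ ⟩
       β * (c * totalCompletion β r α s*) ∎)
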